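{- Consider a run of algorithm LMA on an Exponential Caching input all of whose requested sets have cardinality at most $r$, compared against an offline solution $\mathrm{OPT}$ with valid partitionings $p^*_0,p^*_1,\dots$. Fix a step $t$ and consider its second part: after LMA has finished processing $R_t$, LMA does nothing, while OPT changes its partitioning from $p^*_{t-1}$ to $p^*_t$, paying $\Delta\mathrm{OPT}=\sum_{z:\,p^*_t(z)\ne p^*_{t-1}(z)}\max\{2^{p^*_{t-1}(z)},2^{p^*_t(z)}\}$. Then the resulting change $\Delta\Phi$ of $\Phi=\sum_{u\in U}\Phi_u$ satisfies $$\Delta\mathrm{LMA}+\Delta\Phi\le(2\alpha+2\gamma+\beta)\cdot 2^{\kappa}\cdot\Delta\mathrm{OPT}=O(r^2)\cdot\Delta\mathrm{OPT},$$ where $\Delta\mathrm{LMA}=0$.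
   Context: Exponential Caching: $|U|=2^w-1$; with $[w]=\{0,\dots,w-1\}$, a partitioning $p:U\to[w]$ is valid if $|p^{ -1}(i)|=2^i$; chunks $S_i=p^{ -1}(i)$. LMA maintains a valid partitioning $p$ and budgets $b(z)$, initially $0$. fetch$(z)$: if $\ell=p(z)>0$, for $i=0,\dots,\ell-1$ pick $a_i$ uniformly at random from $S_i$, then move $z$ from $S_\ell$ to $S_0$ and each $a_i$ from $S_i$ to $S_{i+1}$; in all cases set $b(z)\gets0$. On request $R$: let $x\in R$ minimize $p(x)$, $\ell=p(x)$ (at the time of the request); pay access cost $2^\ell$; execute fetch$(x)$; for each $y\in R\setminus\{x\}$ set $b(y)\gets b(y)+2^\ell$; then while some $z$ has $b(z)\ge 2^{p(z)}$, execute fetch$(z)$. Parameters and potential: $\alpha=7$, $\gamma=7r-6$, $\beta=21r-11$, $\kappa=\lceil\log_2\beta\rceil$; for LMA's $p,b$ and OPT's current partitioning $p^*$, $\Phi_u=\alpha\,b(u)$ if $p(u)\le p^*(u)+\kappa$, and $\Phi_u=\beta\,2^{p(u)}-\gamma\,b(u)$ if $p(u)\ge p^*(u)+\kappa+1$. -}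

module Defs where

open import Data.Nat using (ℕ; zero; suc; _+_; _*_; _∸_; _^_; _≤_; _<_; _≥_; _⊔_)
open import Data.Nat.Logarithm using (⌈log₂_⌉)
import Data.Nat as ℕ
open import Data.Integer as ℤ using (ℤ; +_)
open import Data.Fin as Fin using (Fin)
open import Data.List using (List; []; _∷_; length; filter; map; allFin)
open import Data.Nat.ListAction using (sum)
open import Data.List.Membership.Propositional using (_∈_)
open import Data.List.Relation.Unary.Unique.Propositional using (Unique)
open import Data.Bool using (Bool; true; false; if_then_else_)
open import Relation.Nullary using (¬_; Dec; yes; no)
open import Data.Product using (_×_)
open import Relation.Nullary.Decidable using (⌊_⌋; _×-dec_; ¬?)
open import Relation.Binary.PropositionalEquality using (_≡_)

-- Universe U = Fin n.  A partitioning is a map U → ℕ (chunk index).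
Partitioning : ℕ → Set
Partitioning n = Fin n → ℕ

chunkSize : ∀ {n} → Partitioning n → ℕ → ℕ
chunkSize {n} p i = length (filter (λ u → p u ℕ.≟ i) (allFin n))

Valid : (w : ℕ) → Partitioning (2 ^ w ∸ 1) → Set
Valid w p = (∀ u → p u < w) × (∀ i → i < w → chunkSize p i ≡ 2 ^ i)

record State (n : ℕ) : Set where
  constructor ⟨_,_⟩
  field
    part   : Fin n → ℕ
    budget : Fin n → ℕ
open State public

-- Result of fetch(z) when the chosen elements are a : ℕ → Fin n
-- (a i ∈ S_i for i < p z): z goes to S_0, a_i goes from S_i to S_{i+1},
-- budget of z is reset to 0.
fetchResult : ∀ {n} → State n → Fin n → (ℕ → Fin n) → State n
fetchResult {n} s z a = ⟨ p' , b' ⟩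
  where
  p = part s
  ℓ = p z
  p' : Fin n → ℕ
  p' u with u Fin.≟ z
  ... | yes _ = 0
  ... | no _ = if ⌊ (p u ℕ.<? ℓ) ×-dec (u Fin.≟ a (p u)) ⌋ then suc (p u) else p u
  b' : Fin n → ℕ
  b' u with u Fin.≟ z
  ... | yes _ = 0
  ... | no _ = budget s u

-- fetch(z) as a relation (the random choices are existentially chosen:
-- any realisation of the random picks is allowed)
data Fetch {n} (s : State n) (z : Fin n) : State n → Set where
  fetch : (a : ℕ → Fin n) → (∀ i → i < part s z → part s (a i) ≡ i) →
          Fetch s z (fetchResult s z a)

data Loop {n} : State n → State n → Set where
  done : ∀ {s} → (∀ z → budget s z < 2 ^ part s z) → Loop s s
  step : ∀ {s s₁ s₂} (z : Fin n) → budget s z ≥ 2 ^ part s z →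
         Fetch s z s₁ → Loop s₁ s₂ → Loop s s₂

addBudget : ∀ {n} → List (Fin n) → Fin n → ℕ → State n → State n
addBudget {n} R x c s = ⟨ part s , b' ⟩
  where
  open import Data.List.Membership.DecPropositional (Fin._≟_) using (_∈?_)
  b' : Fin n → ℕ
  b' y = if ⌊ (y ∈? R) ×-dec (¬? (y Fin.≟ x)) ⌋
           then budget s y + c else budget s y

data Request {n} (R : List (Fin n)) (s : State n) : State n → Set where
  request : ∀ {s₁ s₂} (x : Fin n) → x ∈ R → (∀ y → y ∈ R → part s x ≤ part s y) →
            Fetch s x s₁ → Loop (addBudget R x (2 ^ part s x) s₁) s₂ →
            Request R s s₂

-- states of LMA reachable after processing some requests R_1..R_t, each a
-- nonempty set (duplicate-free list) of cardinality at most r, starting from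
-- a valid partitioning with all budgets 0
data Reachable (w r : ℕ) : State (2 ^ w ∸ 1) → Set where
  init : (p : Partitioning (2 ^ w ∸ 1)) → Valid w p → Reachable w r ⟨ p , (λ _ → 0) ⟩
  next : ∀ {s s'} (R : List (Fin (2 ^ w ∸ 1))) → Unique R → 1 ≤ length R →
         length R ≤ r → Reachable w r s → Request R s s' → Reachable w r s'

α : ℕ
α = 7

γ β κ : ℕ → ℕ
γ r = 7 * r ∸ 6
β r = 21 * r ∸ 11
κ r = ⌈log₂ β r ⌉

Φu : ∀ {n} (r : ℕ) → State n → Partitioning n → Fin n → ℤ
Φu r s p* u with part s u ℕ.≤? p* u + κ r
... | yes _ = + (α * budget s u)
... | no _ = + (β r * 2 ^ part s u) ℤ.- + (γ r * budget s u)

sumℤ : List ℤ → ℤ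
sumℤ [] = + 0
sumℤ (x ∷ xs) = x ℤ.+ sumℤ xs

Φ : ∀ {n} (r : ℕ) → State n → Partitioning n → ℤ
Φ {n} r s p* = sumℤ (map (Φu r s p*) (allFin n))

ΔOPT : ∀ {n} → Partitioning n → Partitioning n → ℕ
ΔOPT {n} old new =
  sum (map (λ z → 2 ^ old z ⊔ 2 ^ new z)
           (filter (λ z → ¬? (old z ℕ.≟ new z)) (allFin n)))

-- LMA does not move, so Φ changes only at elements u whose OPT-level changes, and
-- only when u switches regime. Entering the regime p(u) ≥ p*(u) + κ + 1 raises Φ_u
-- by at most β 2^{p(u)}; leaving it raises Φ_u by at most (α + γ) b(u), and
-- b(u) < 2^{p(u)} in every state LMA reaches, because its while-loop stops only then.
-- In both cases p(u) ≤ p*(u) + κ for the OPT-level of the low regime, so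
-- 2^{p(u)} ≤ 2^κ max(2^{p*_{t-1}(u)}, 2^{p*_t(u)}), which is u's contribution to ΔOPT.
module Submission where

open import Defs
open import Data.Nat using (ℕ; _+_; _*_; _∸_; _^_; _≤_; _<_; _⊔_; z≤n; _≤?_; _≟_)
open import Data.Nat.Properties
  using (≤-trans; *-mono-≤; *-monoʳ-≤; ^-monoʳ-≤; ^-distribˡ-+-*; *-comm; *-assoc;
         *-distribˡ-+; *-distribʳ-+; +-mono-≤; m≤m+n; m≤n+m; m≤n*m; m≤m⊔n; m≤n⊔m;
         <⇒≤; m^n>0; module ≤-Reasoning)
open import Data.Integer as ℤ using (ℤ; +_; +≤+)
import Data.Integer.Properties as ℤₚ
open ℤₚ using (i-j≤i; i≤j⇒i-k≤j)
open import Data.Integer.Tactic.RingSolver using (solve-∀)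
open import Data.List using ([]; _∷_; map; filter; allFin)
open import Data.Nat.ListAction using (sum)
open import Data.Empty using (⊥-elim)
open import Relation.Nullary using (¬_; yes; no)
open import Relation.Nullary.Decidable using (¬?; decidable-stable)
open import Relation.Unary using (Pred; Decidable)
open import Relation.Binary.PropositionalEquality using (_≡_; refl; sym; trans; cong; subst)

BudgetsBelowCapacity : ∀ {n} → State n → Set
BudgetsBelowCapacity s = ∀ z → budget s z < 2 ^ part s z

loop-budgets : ∀ {n} {s s′ : State n} → Loop s s′ → BudgetsBelowCapacity s′
loop-budgets (done b<2^p)   = b<2^p
loop-budgets (step _ _ _ l) = loop-budgets l

reachable-budgets : ∀ {w r s} → Reachable w r s → BudgetsBelowCapacity s
reachable-budgets (init p _) z = m^n>0 2 (p z)
reachable-budgets (next _ _ _ _ _ (request _ _ _ _ l)) = loop-budgets l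

i-i≤+n : ∀ i n → i ℤ.- i ℤ.≤ + n
i-i≤+n i n = ℤₚ.≤-trans (ℤₚ.≤-reflexive (ℤₚ.+-inverseʳ i)) (+≤+ z≤n)

i-[j-k]≤i+k : ∀ a b c → + a ℤ.- (+ b ℤ.- + c) ℤ.≤ + (a + c)
i-[j-k]≤i+k a b c = ℤₚ.≤-trans (ℤₚ.≤-reflexive (regroup (+ a) (+ b) (+ c))) (i-j≤i (+ (a + c)) (+ b))
  where
  regroup : ∀ i j k → i ℤ.- (j ℤ.- k) ≡ (i ℤ.+ k) ℤ.- j
  regroup = solve-∀

scaled-pow-≤ : ∀ {c} d k {ℓ m} p → c ≤ d → p ≤ ℓ + k → 2 ^ ℓ ≤ m → c * 2 ^ p ≤ d * 2 ^ k * m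
scaled-pow-≤ {c} d k {ℓ} {m} p c≤d p≤ℓ+k 2^ℓ≤m = begin
  c * 2 ^ p           ≤⟨ *-mono-≤ c≤d (^-monoʳ-≤ 2 p≤ℓ+k) ⟩
  d * 2 ^ (ℓ + k)     ≡⟨ cong (d *_) (trans (^-distribˡ-+-* 2 ℓ k) (*-comm (2 ^ ℓ) (2 ^ k))) ⟩
  d * (2 ^ k * 2 ^ ℓ) ≡⟨ sym (*-assoc d (2 ^ k) (2 ^ ℓ)) ⟩
  d * 2 ^ k * 2 ^ ℓ   ≤⟨ *-monoʳ-≤ (d * 2 ^ k) 2^ℓ≤m ⟩
  d * 2 ^ k * m       ∎
  where open ≤-Reasoning

C : ℕ → ℕ
C r = 2 * α + 2 * γ r + β r

β≤C : ∀ r → β r ≤ C r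
β≤C r = m≤n+m (β r) (2 * α + 2 * γ r)

α+γ≤C : ∀ r → α + γ r ≤ C r
α+γ≤C r = ≤-trans (+-mono-≤ (m≤n*m α 2) (m≤n*m (γ r) 2)) (m≤m+n (2 * α + 2 * γ r) (β r))

Φu-cong : ∀ {n} r (s : State n) (p q : Partitioning n) u → p u ≡ q u → Φu r s p u ≡ Φu r s q u
Φu-cong r s p q u pu≡qu with part s u ≤? p u + κ r | part s u ≤? q u + κ r
... | yes _ | yes _ = refl
... | no _  | no _  = refl
... | yes h | no ¬h = ⊥-elim (¬h (subst (λ ℓ → part s u ≤ ℓ + κ r) pu≡qu h))
... | no ¬h | yes h = ⊥-elim (¬h (subst (λ ℓ → part s u ≤ ℓ + κ r) (sym pu≡qu) h))

Φu-change-≤ : ∀ {n} r (s : State n) → BudgetsBelowCapacity s → (p q : Partitioning n) → ∀ u →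
  Φu r s q u ℤ.- Φu r s p u ℤ.≤ + (C r * 2 ^ κ r * (2 ^ p u ⊔ 2 ^ q u))
Φu-change-≤ r s b<2^ℓ p q u with part s u ≤? q u + κ r | part s u ≤? p u + κ r
... | yes _ | yes _ = i-i≤+n (+ (α * budget s u)) _
... | no _  | no _  = i-i≤+n (+ (β r * 2 ^ part s u) ℤ.- + (γ r * budget s u)) _
... | no _  | yes ℓ≤p+κ = ℤₚ.≤-trans
  (i≤j⇒i-k≤j (+ (α * b)) (i-j≤i (+ (β r * 2 ^ ℓ)) (+ (γ r * b))))
  (+≤+ (scaled-pow-≤ (C r) (κ r) ℓ (β≤C r) ℓ≤p+κ (m≤m⊔n (2 ^ p u) (2 ^ q u))))
  where ℓ = part s u; b = budget s u
... | yes ℓ≤q+κ | no _ = ℤₚ.≤-trans (i-[j-k]≤i+k (α * b) (β r * 2 ^ ℓ) (γ r * b)) (+≤+ (begin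
  α * b + γ r * b     ≡⟨ sym (*-distribʳ-+ b α (γ r)) ⟩
  (α + γ r) * b       ≤⟨ *-monoʳ-≤ (α + γ r) (<⇒≤ (b<2^ℓ u)) ⟩
  (α + γ r) * 2 ^ ℓ   ≤⟨ scaled-pow-≤ (C r) (κ r) ℓ (α+γ≤C r) ℓ≤q+κ (m≤n⊔m (2 ^ p u) (2 ^ q u)) ⟩
  C r * 2 ^ κ r * (2 ^ p u ⊔ 2 ^ q u) ∎))
  where ℓ = part s u; b = budget s u; open ≤-Reasoning

sumℤ-map-sub-≤ : ∀ {a ℓ} {A : Set a} {P : Pred A ℓ} (P? : Decidable P) (f g : A → ℤ) (c : ℕ) (h : A → ℕ) →
  (∀ x → P x → f x ℤ.- g x ℤ.≤ + (c * h x)) → (∀ x → ¬ P x → f x ≡ g x) →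
  ∀ xs → sumℤ (map f xs) ℤ.- sumℤ (map g xs) ℤ.≤ + (c * sum (map h (filter P? xs)))
sumℤ-map-sub-≤ P? f g c h bound equal [] = +≤+ z≤n
sumℤ-map-sub-≤ P? f g c h bound equal (x ∷ xs) with P? x
... | yes px = ℤₚ.≤-trans (ℤₚ.≤-reflexive (interchange (f x) _ (g x) _))
  (ℤₚ.≤-trans (ℤₚ.+-mono-≤ (bound x px) (sumℤ-map-sub-≤ P? f g c h bound equal xs))
    (ℤₚ.≤-reflexive (cong +_ (sym (*-distribˡ-+ c (h x) _)))))
  where
  interchange : ∀ i j k l → (i ℤ.+ j) ℤ.- (k ℤ.+ l) ≡ (i ℤ.- k) ℤ.+ (j ℤ.- l)
  interchange = solve-∀
... | no ¬px rewrite equal x ¬px = ℤₚ.≤-trans (ℤₚ.≤-reflexive (cancel (g x) _ _))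
  (sumℤ-map-sub-≤ P? f g c h bound equal xs)
  where
  cancel : ∀ i j k → (i ℤ.+ j) ℤ.- (i ℤ.+ k) ≡ j ℤ.- k
  cancel = solve-∀

lemma8 : (w r : ℕ) → 1 ≤ r →
    (s : State (2 ^ w ∸ 1)) → Reachable w r s →
    (pOld pNew : Partitioning (2 ^ w ∸ 1)) → Valid w pOld → Valid w pNew →
    (+ 0) ℤ.+ (Φ r s pNew ℤ.- Φ r s pOld)
      ℤ.≤ + ((2 * α + 2 * γ r + β r) * 2 ^ κ r * ΔOPT pOld pNew)
lemma8 w r _ s reach pOld pNew _ _ = ℤₚ.≤-trans (ℤₚ.≤-reflexive (ℤₚ.+-identityˡ _))
  (sumℤ-map-sub-≤ (λ z → ¬? (pOld z ≟ pNew z)) (Φu r s pNew) (Φu r s pOld)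
    (C r * 2 ^ κ r) (λ z → 2 ^ pOld z ⊔ 2 ^ pNew z)
    (λ u _ → Φu-change-≤ r s (reachable-budgets reach) pOld pNew u)
    (λ u unchanged → Φu-cong r s pNew pOld u (sym (decidable-stable (pOld u ≟ pNew u) unchanged)))
    (allFin _))
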